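{- For every $n\geq 1$, the number of shallow $132$-avoiding involutions of length $n$ is $F_{n+1}$, the $(n+1)$-st Fibonacci number.
   Context: For $\pi=\pi_1\cdots\pi_n \in S_n$: $D(\pi)=\sum_{i=1}^n|\pi_i-i|$; $I(\pi)=|\{(i,j): i<j,\ \pi_i>\pi_j\}|$; $T(\pi)=n-\mathrm{cyc}(\pi)$ where $\mathrm{cyc}(\pi)$ is the number of cycles of $\pi$. $\pi$ is shallow if $I(\pi)+T(\pi)=D(\pi)$. $\pi$ avoids $132$ if there are no $i<j<k$ with $\pi_i<\pi_k<\pi_j$. An involution is a permutation with $\pi=\pi^{ -1}$. Fibonacci numbers: $F_1=F_2=1$, $F_m=F_{m-1}+F_{m-2}$. -}

module Defs where

open import Data.Nat using (ℕ; zero; suc; _+_; _∸_; _<ᵇ_; _≤ᵇ_; _≡ᵇ_; ∣_-_∣)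
open import Data.Bool using (Bool; true; false; _∧_; _∨_; not; if_then_else_)
open import Data.Fin using (Fin; toℕ)
open import Data.Vec using (Vec; lookup)
open import Data.List using (List; map; allFin; upTo)
open import Data.Nat.ListAction using (sum)
open import Data.Bool.ListAction using (all; any)

-- Permutations π = π₁⋯πₙ ∈ Sₙ are represented by their one-line notation as a
-- word w : Vec (Fin n) n, with position i (0-based) holding value lookup w i,
-- together with the condition isPerm w (all letters distinct).  This is π with
-- both positions and values shifted down by 1, which changes none of
-- D, I, cyc, involution-ness, 132-avoidance.

count : {A : Set} → (A → Bool) → List A → ℕ
count p xs = sum (map (λ x → if p x then 1 else 0) xs)

_⇒ᵇ_ : Bool → Bool → Bool
a ⇒ᵇ b = not a ∨ b

iter : {A : Set} → (A → A) → ℕ → A → A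
iter f zero    x = x
iter f (suc k) x = f (iter f k x)

module _ {n : ℕ} (w : Vec (Fin n) n) where

  π : Fin n → Fin n
  π i = lookup w i

  val : Fin n → ℕ
  val i = toℕ (π i)

  isPerm : Bool
  isPerm = all (λ i → all (λ j → (toℕ i <ᵇ toℕ j) ⇒ᵇ not (val i ≡ᵇ val j))
                           (allFin n)) (allFin n)

  isInvolution : Bool
  isInvolution = all (λ i → toℕ (π (π i)) ≡ᵇ toℕ i) (allFin n)

  D : ℕ
  D = sum (map (λ i → ∣ val i - toℕ i ∣) (allFin n))

  I : ℕ
  I = sum (map (λ i → count (λ j → (toℕ i <ᵇ toℕ j) ∧ (val j <ᵇ val i))
                            (allFin n)) (allFin n))

  -- cyc(π): number of cycles, counted by their minimal elements:
  -- i is the minimum of its cycle iff i ≤ πᵏ(i) for all k = 0,…,n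
  cyc : ℕ
  cyc = count (λ i → all (λ k → toℕ i ≤ᵇ toℕ (iter π k i)) (upTo (suc n)))
              (allFin n)

  T : ℕ
  T = n ∸ cyc

  isShallow : Bool
  isShallow = (I + T) ≡ᵇ D

  avoids132 : Bool
  avoids132 = not (any (λ i → any (λ j → any (λ k →
                 (toℕ i <ᵇ toℕ j) ∧ (toℕ j <ᵇ toℕ k)
                 ∧ (val i <ᵇ val k) ∧ (val k <ᵇ val j))
                 (allFin n)) (allFin n)) (allFin n))

fib : ℕ → ℕ
fib zero = 0
fib (suc zero) = 1
fib (suc (suc m)) = fib (suc m) + fib m

ShallowInv132 : ℕ → Set
ShallowInv132 n = Σ (Vec (Fin n) n) λ w →
  T' (isPerm w ∧ isInvolution w ∧ avoids132 w ∧ isShallow w)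
  where
    open import Data.Product using (Σ)
    open import Data.Bool using () renaming (T to T')

module Submission where

-- Splitting the 2-cycle (k n) through the
-- last point into two fixed points lowers D by exactly 2(n − k), and lowers I + T by 2(n − k) minus the number
-- of inversions of the new involution that involve k; by induction I + T ≤ D for every involution.  Hence in a
-- shallow involution no inversion involves k after the split, and together with 132-avoidance this forces
-- k = 1: the last point is fixed or exchanged with the first one.  Deleting that fixed point, or deleting the
-- 2-cycle (1 n) and shifting the other points down by one, are bijections onto the shallow 132-avoiding
-- involutions of lengths n − 1 and n − 2, which gives the Fibonacci recurrence.

open import Data.Bool using (Bool; true; false; T; not; _∧_; if_then_else_)
open import Data.Bool.Properties using (T-≡; T-∧; T-irrelevant; ∧-identityʳ; ∧-zeroʳ)
open import Data.Bool.ListAction using (all; any)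
open import Data.Empty using (⊥; ⊥-elim)
open import Data.Fin as Fin using (Fin; toℕ; fromℕ<)
open import Data.Fin.Properties using (toℕ<n; toℕ-injective; toℕ-fromℕ<; nonZeroIndex; +↔⊎)
open import Data.List using (map; allFin; upTo) renaming (tabulate to tabulateᴸ)
open import Data.List.Properties using (map-tabulate)
import Data.List.Relation.Unary.All.Properties as All
import Data.List.Relation.Unary.Any.Properties as Any
open All using (all⁺; all⁻)
open Any using (any⁺; any⁻)
open import Data.Nat
open import Data.Nat.DivMod using (_mod_; _%_; m<n⇒m%n≡m)
open import Data.Nat.ListAction using (sum)
open import Data.Nat.Properties
open import Data.Nat.Tactic.RingSolver using (solve-∀)
open import Algebra.Properties.CommutativeSemigroup +-commutativeSemigroup
  using (interchange; xy∙z≈xz∙y; x∙yz≈y∙xz)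
open import Data.Product using (_×_; _,_; proj₁; proj₂; Σ)
open import Data.Sum using (_⊎_; inj₁; inj₂)
open import Data.Sum.Function.Propositional using (_⊎-↔_)
open import Data.Vec using (Vec; []; _∷_; lookup; tabulate)
open import Data.Vec.Properties using (lookup∘tabulate)
open import Function.Base using (_∘_; id)
open import Function.Bundles using (Equivalence; _⇔_; mk⇔; _↔_; mk↔ₛ′)
open import Function.Construct.Composition using (_↔-∘_)
open import Function.Construct.Symmetry using (↔-sym)
open import Relation.Binary using (Tri; tri<; tri≈; tri>)
open import Relation.Binary.PropositionalEquality
  using (_≡_; _≢_; refl; sym; trans; cong; cong₂; subst; subst₂; ≢-sym; module ≡-Reasoning)
open import Relation.Nullary using (¬_; yes; no)
open import Relation.Nullary.Decidable using (recompute; T?)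

open import Defs using (ShallowInv132; fib; iter)

-- Finite sums and Boolean indicators

∑< : ℕ → (ℕ → ℕ) → ℕ
∑< zero    h = 0
∑< (suc n) h = h 0 + ∑< n (h ∘ suc)

syntax ∑< n (λ i → h) = ∑[ i < n ] h

𝟙 : Bool → ℕ
𝟙 b = if b then 1 else 0

Agree : ℕ → (ℕ → ℕ) → (ℕ → ℕ) → Set
Agree n f g = ∀ i → i < n → f i ≡ g i

<ᵇ-true : ∀ {m n} → m < n → (m <ᵇ n) ≡ true
<ᵇ-true m<n = Equivalence.to T-≡ (<⇒<ᵇ m<n)

<ᵇ-false : ∀ {m n} → n ≤ m → (m <ᵇ n) ≡ false
<ᵇ-false {m} {n} n≤m with m <ᵇ n in eq
... | true  = ⊥-elim (<⇒≱ (<ᵇ⇒< m n (Equivalence.from T-≡ eq)) n≤m)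
... | false = refl

≡ᵇ-true : ∀ n → (n ≡ᵇ n) ≡ true
≡ᵇ-true n = Equivalence.to T-≡ (≡⇒≡ᵇ n n refl)

≡ᵇ-false : ∀ {m n} → m ≢ n → (m ≡ᵇ n) ≡ false
≡ᵇ-false {m} {n} m≢n with m ≡ᵇ n in eq
... | true  = ⊥-elim (m≢n (≡ᵇ⇒≡ m n (Equivalence.from T-≡ eq)))
... | false = refl

T-injective : ∀ {a b} → (T a → T b) → (T b → T a) → a ≡ b
T-injective {false} {false} _   _   = refl
T-injective {false} {true}  _   b⇒a = ⊥-elim (b⇒a _)
T-injective {true}  {false} a⇒b _   = ⊥-elim (a⇒b _)
T-injective {true}  {true}  _   _   = refl

T-not⁺ : ∀ {b} → ¬ T b → T (not b)
T-not⁺ {false} _  = _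
T-not⁺ {true}  ¬t = ¬t _

T-not⁻ : ∀ {b} → T (not b) → ¬ T b
T-not⁻ {false} _ ()
T-not⁻ {true}  ()

≤ᵇ≡not<ᵇ : ∀ m n → (m ≤ᵇ n) ≡ not (n <ᵇ m)
≤ᵇ≡not<ᵇ m n = T-injective
  (λ m≤n → T-not⁺ (λ n<m → <⇒≱ (<ᵇ⇒< n m n<m) (≤ᵇ⇒≤ m n m≤n)))
  (λ n≮m → ≤⇒≤ᵇ {m} {n} (≮⇒≥ (T-not⁻ n≮m ∘ <⇒<ᵇ)))

𝟙-not : ∀ b → 𝟙 (not b) + 𝟙 b ≡ 1
𝟙-not false = refl
𝟙-not true  = refl

∑-cong : ∀ n {h h′} → Agree n h h′ → ∑< n h ≡ ∑< n h′
∑-cong zero    eq = refl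
∑-cong (suc n) eq = cong₂ _+_ (eq 0 z<s) (∑-cong n (λ i i<n → eq (suc i) (s<s i<n)))

∑-init-last : ∀ n h → ∑< (suc n) h ≡ ∑< n h + h n
∑-init-last zero    h = +-comm (h 0) 0
∑-init-last (suc n) h = begin
  h 0 + ∑< (suc n) (h ∘ suc)         ≡⟨ cong (h 0 +_) (∑-init-last n (h ∘ suc)) ⟩
  h 0 + (∑< n (h ∘ suc) + h (suc n)) ≡⟨ +-assoc (h 0) _ _ ⟨
  h 0 + ∑< n (h ∘ suc) + h (suc n)   ∎
  where open ≡-Reasoning

∑-distrib-+ : ∀ n h h′ → ∑[ i < n ] (h i + h′ i) ≡ ∑< n h + ∑< n h′
∑-distrib-+ zero    h h′ = refl
∑-distrib-+ (suc n) h h′ = begin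
  h 0 + h′ 0 + ∑[ i < n ] (h (suc i) + h′ (suc i))
    ≡⟨ cong (h 0 + h′ 0 +_) (∑-distrib-+ n (h ∘ suc) (h′ ∘ suc)) ⟩
  h 0 + h′ 0 + (∑< n (h ∘ suc) + ∑< n (h′ ∘ suc))
    ≡⟨ interchange (h 0) (h′ 0) _ _ ⟩
  h 0 + ∑< n (h ∘ suc) + (h′ 0 + ∑< n (h′ ∘ suc)) ∎
  where open ≡-Reasoning

∑-const : ∀ n c → ∑[ i < n ] c ≡ n * c
∑-const zero    c = refl
∑-const (suc n) c = cong (c +_) (∑-const n c)

∑-exchange : ∀ n k h h′ → k < n → (∀ i → i < n → i ≢ k → h i ≡ h′ i) →
             ∑< n h + h′ k ≡ ∑< n h′ + h k
∑-exchange (suc n) zero h h′ _ eq = begin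
  h 0 + ∑< n (h ∘ suc) + h′ 0  ≡⟨ cong (λ x → h 0 + x + h′ 0) (∑-cong n (λ i i<n → eq (suc i) (s<s i<n) λ ())) ⟩
  h 0 + ∑< n (h′ ∘ suc) + h′ 0 ≡⟨ swap (h 0) _ (h′ 0) ⟩
  h′ 0 + ∑< n (h′ ∘ suc) + h 0 ∎
  where
  open ≡-Reasoning
  swap : ∀ a b c → a + b + c ≡ c + b + a
  swap = solve-∀
∑-exchange (suc n) (suc k) h h′ (s<s k<n) eq = begin
  h 0 + ∑< n (h ∘ suc) + h′ (suc k)    ≡⟨ +-assoc (h 0) _ _ ⟩
  h 0 + (∑< n (h ∘ suc) + h′ (suc k))  ≡⟨ cong₂ _+_ (eq 0 z<s λ ()) (∑-exchange n k _ _ k<n tail) ⟩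
  h′ 0 + (∑< n (h′ ∘ suc) + h (suc k)) ≡⟨ +-assoc (h′ 0) _ _ ⟨
  h′ 0 + ∑< n (h′ ∘ suc) + h (suc k)   ∎
  where
  open ≡-Reasoning
  tail : ∀ i → i < n → i ≢ k → h (suc i) ≡ h′ (suc i)
  tail i i<n i≢k = eq (suc i) (s<s i<n) (i≢k ∘ suc-injective)

∑-term-≤ : ∀ n k h → k < n → h k ≤ ∑< n h
∑-term-≤ (suc n) zero    h _         = m≤m+n (h 0) _
∑-term-≤ (suc n) (suc k) h (s<s k<n) = ≤-trans (∑-term-≤ n k (h ∘ suc) k<n) (m≤n+m _ (h 0))

∑-count-above : ∀ n k → ∑[ i < n ] 𝟙 (k <ᵇ i) ≡ n ∸ suc k
∑-count-above zero    k       = refl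
∑-count-above (suc n) zero    = trans (∑-const n 1) (*-identityʳ n)
∑-count-above (suc n) (suc k) = ∑-count-above n k

∑-zero : ∀ n {h} → (∀ i → i < n → h i ≡ 0) → ∑< n h ≡ 0
∑-zero n eq = trans (∑-cong n eq) (trans (∑-const n 0) (*-zeroʳ n))

cross : ℕ → (ℕ → ℕ → ℕ) → ℕ → ℕ
cross n Q k = ∑< n (Q k) + ∑[ i < n ] Q i k

∑∑-exchange : ∀ n k (Q Q′ : ℕ → ℕ → ℕ) → k < n → Q k k ≡ Q′ k k →
              (∀ i j → i < n → j < n → i ≢ k → j ≢ k → Q i j ≡ Q′ i j) →
              ∑[ i < n ] ∑< n (Q i) + cross n Q′ k ≡ ∑[ i < n ] ∑< n (Q′ i) + cross n Q k
∑∑-exchange n k Q Q′ k<n Qkk eq = +-cancelʳ-≡ (Q k k) _ _ (begin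
  A + (r′ + c′) + Q k k   ≡⟨ regroup A r′ c′ (Q k k) ⟩
  (A + c′) + (r′ + Q k k) ≡⟨ cong (_+ (r′ + Q k k)) (∑-distrib-+ n R col′) ⟨
  ∑< n h + h′ k          ≡⟨ ∑-exchange n k h h′ k<n rows ⟩
  ∑< n h′ + h k          ≡⟨ cong (λ x → x + (r + Q′ k k)) (∑-distrib-+ n R′ col) ⟩
  (A′ + c) + (r + Q′ k k) ≡⟨ cong (λ y → A′ + c + (r + y)) (sym Qkk) ⟩
  (A′ + c) + (r + Q k k)  ≡⟨ regroup A′ r c (Q k k) ⟨
  A′ + (r + c) + Q k k    ∎)
  where
  open ≡-Reasoning
  R R′ col col′ h h′ : ℕ → ℕ
  A A′ r r′ c c′ : ℕ
  R i = ∑< n (Q i)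
  R′ i = ∑< n (Q′ i)
  col i = Q i k
  col′ i = Q′ i k
  h i = R i + col′ i
  h′ i = R′ i + col i
  A = ∑< n R
  A′ = ∑< n R′
  r = R k
  r′ = R′ k
  c = ∑< n col
  c′ = ∑< n col′
  regroup : ∀ a b c d → a + (b + c) + d ≡ (a + c) + (b + d)
  regroup = solve-∀
  rows : ∀ i → i < n → i ≢ k → h i ≡ h′ i
  rows i i<n i≢k = ∑-exchange n k (Q i) (Q′ i) k<n (λ j j<n j≢k → eq i j i<n j<n i≢k j≢k)

-- Involutions of ℕ below n and their statistics

Involution : ℕ → (ℕ → ℕ) → Set
Involution n f = ∀ i → i < n → f i < n × f (f i) ≡ i

Pattern132 : (ℕ → ℕ) → ℕ → ℕ → ℕ → Set
Pattern132 f i j k = i < j × j < k × f i < f k × f k < f j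

Avoids132 : ℕ → (ℕ → ℕ) → Set
Avoids132 n f = ∀ i j k → k < n → ¬ Pattern132 f i j k

displacement : ℕ → (ℕ → ℕ) → ℕ
displacement n f = ∑[ i < n ] ∣ f i - i ∣

inversion : (ℕ → ℕ) → ℕ → ℕ → ℕ
inversion f i j = 𝟙 ((i <ᵇ j) ∧ (f j <ᵇ f i))

inversions : ℕ → (ℕ → ℕ) → ℕ
inversions n f = ∑[ i < n ] ∑< n (inversion f i)

-- For an involution T = n − cyc is the number of 2-cycles, counted here at their larger points.
transpositions : ℕ → (ℕ → ℕ) → ℕ
transpositions n f = ∑[ i < n ] 𝟙 (f i <ᵇ i)

Shallow : ℕ → (ℕ → ℕ) → Set
Shallow n f = inversions n f + transpositions n f ≡ displacement n f

IsShallowInv132 : ℕ → (ℕ → ℕ) → Set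
IsShallowInv132 n f = Involution n f × Avoids132 n f × Shallow n f

involution-injective : ∀ n f {i j} → Involution n f → i < n → j < n → f i ≡ f j → i ≡ j
involution-injective n f {i} {j} inv i<n j<n fi≡fj = begin
  i         ≡⟨ proj₂ (inv i i<n) ⟨
  f (f i)   ≡⟨ cong f fi≡fj ⟩
  f (f j)   ≡⟨ proj₂ (inv j j<n) ⟩
  j         ∎
  where open ≡-Reasoning

involution-below : ∀ n f {i} → Involution (suc n) f → i < n → i ≢ f n → f i < n
involution-below n f {i} inv i<n i≢fn = ≤∧≢⇒< (s≤s⁻¹ (proj₁ (inv i (m<n⇒m<1+n i<n)))) fi≢n
  where
  fi≢n : f i ≢ n
  fi≢n fi≡n = i≢fn (trans (sym (proj₂ (inv i (m<n⇒m<1+n i<n)))) (cong f fi≡n))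

involution-restrict : ∀ n f → Involution (suc n) f → f n ≡ n → Involution n f
involution-restrict n f inv fn≡n i i<n =
  involution-below n f inv i<n (λ i≡fn → <⇒≢ i<n (trans i≡fn fn≡n)) , proj₂ (inv i (m<n⇒m<1+n i<n))

-- Splitting off the 2-cycle through the last point: I + T ≤ D

fixAt : ℕ → (ℕ → ℕ) → ℕ → ℕ
fixAt k f i = if i ≡ᵇ k then k else f i

fixAt-≡ : ∀ k f → fixAt k f k ≡ k
fixAt-≡ k f rewrite ≡ᵇ-true k = refl

fixAt-≢ : ∀ k f {i} → i ≢ k → fixAt k f i ≡ f i
fixAt-≢ k f i≢k rewrite ≡ᵇ-false i≢k = refl

module TwoCycle {n : ℕ} {f : ℕ → ℕ} (inv : Involution (suc n) f) (k<n : f n < n) where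
  open ≡-Reasoning

  k : ℕ
  k = f n

  s : ℕ → ℕ
  s = fixAt k f

  f-k : f k ≡ n
  f-k = proj₂ (inv n ≤-refl)

  f-≢k : ∀ i → i < n → f i ≢ k
  f-≢k i i<n fi≡k = <⇒≢ i<n (trans (sym (proj₂ (inv i (m<n⇒m<1+n i<n)))) (trans (cong f fi≡k) f-k))

  s-involution : Involution n s
  s-involution i i<n with i ≟ k
  ... | yes refl = subst (_< n) (sym (fixAt-≡ k f)) k<n , trans (cong s (fixAt-≡ k f)) (fixAt-≡ k f)
  ... | no i≢k = subst (_< n) (sym (fixAt-≢ k f i≢k)) (involution-below n f inv i<n i≢k) , (begin
    s (s i)   ≡⟨ cong s (fixAt-≢ k f i≢k) ⟩
    s (f i)   ≡⟨ fixAt-≢ k f (f-≢k i i<n) ⟩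
    f (f i)   ≡⟨ proj₂ (inv i (m<n⇒m<1+n i<n)) ⟩
    i         ∎)

  ∑-fixAt : ∀ (φ : ℕ → ℕ → ℕ) → ∑[ i < n ] φ i (f i) + φ k k ≡ ∑[ i < n ] φ i (s i) + φ k n
  ∑-fixAt φ = begin
    ∑[ i < n ] φ i (f i) + φ k k     ≡⟨ cong (λ x → ∑[ i < n ] φ i (f i) + φ k x) (fixAt-≡ k f) ⟨
    ∑[ i < n ] φ i (f i) + φ k (s k) ≡⟨ ∑-exchange n k _ _ k<n (λ i _ i≢k → sym (cong (φ i) (fixAt-≢ k f i≢k))) ⟩
    ∑[ i < n ] φ i (s i) + φ k (f k) ≡⟨ cong (λ x → ∑[ i < n ] φ i (s i) + φ k x) f-k ⟩
    ∑[ i < n ] φ i (s i) + φ k n     ∎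

∑-reindex : ∀ n f → Involution n f → ∀ h → ∑[ i < n ] h (f i) ≡ ∑< n h
∑-reindex zero    f inv h = refl
∑-reindex (suc n) f inv h with m<1+n⇒m<n∨m≡n (proj₁ (inv n ≤-refl))
... | inj₂ fn≡n = begin
  ∑[ i < suc n ] h (f i)       ≡⟨ ∑-init-last n _ ⟩
  ∑[ i < n ] h (f i) + h (f n) ≡⟨ cong₂ _+_ (∑-reindex n f (involution-restrict n f inv fn≡n) h) (cong h fn≡n) ⟩
  ∑< n h + h n                 ≡⟨ ∑-init-last n h ⟨
  ∑< (suc n) h                 ∎
  where open ≡-Reasoning
... | inj₁ k<n = begin
  ∑[ i < suc n ] h (f i)   ≡⟨ ∑-init-last n _ ⟩
  ∑[ i < n ] h (f i) + h k ≡⟨ ∑-fixAt (λ _ → h) ⟩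
  ∑[ i < n ] h (s i) + h n ≡⟨ cong (_+ h n) (∑-reindex n s s-involution h) ⟩
  ∑< n h + h n             ≡⟨ ∑-init-last n h ⟨
  ∑< (suc n) h             ∎
  where
  open ≡-Reasoning
  open TwoCycle inv k<n

inversions-init-last : ∀ n f → inversions (suc n) f ≡ inversions n f + ∑[ i < n ] 𝟙 (f n <ᵇ f i)
inversions-init-last n f = begin
  inversions (suc n) f
    ≡⟨ ∑-init-last n _ ⟩
  ∑[ i < n ] ∑< (suc n) (inversion f i) + ∑< (suc n) (inversion f n)
    ≡⟨ cong₂ _+_ (∑-cong n last-column) (∑-zero (suc n) last-row) ⟩
  ∑[ i < n ] (∑< n (inversion f i) + 𝟙 (f n <ᵇ f i)) + 0
    ≡⟨ +-identityʳ _ ⟩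
  ∑[ i < n ] (∑< n (inversion f i) + 𝟙 (f n <ᵇ f i))
    ≡⟨ ∑-distrib-+ n _ _ ⟩
  inversions n f + ∑[ i < n ] 𝟙 (f n <ᵇ f i) ∎
  where
  open ≡-Reasoning
  last-column : ∀ i → i < n → ∑< (suc n) (inversion f i) ≡ ∑< n (inversion f i) + 𝟙 (f n <ᵇ f i)
  last-column i i<n rewrite ∑-init-last n (inversion f i) | <ᵇ-true i<n = refl
  last-row : ∀ j → j < suc n → inversion f n j ≡ 0
  last-row j j<1+n rewrite <ᵇ-false (s≤s⁻¹ j<1+n) = refl

module TwoCycleStatistics {n : ℕ} {f : ℕ → ℕ} (inv : Involution (suc n) f) (k<n : f n < n) where
  open TwoCycle inv k<n public
  open ≡-Reasoning

  ∑-fixAt′ : ∀ (φ : ℕ → ℕ → ℕ) → φ k k ≡ 0 → ∑[ i < n ] φ i (f i) ≡ ∑[ i < n ] φ i (s i) + φ k n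
  ∑-fixAt′ φ φkk≡0 = begin
    ∑[ i < n ] φ i (f i)              ≡⟨ +-identityʳ _ ⟨
    ∑[ i < n ] φ i (f i) + 0          ≡⟨ cong (∑[ i < n ] φ i (f i) +_) φkk≡0 ⟨
    ∑[ i < n ] φ i (f i) + φ k k      ≡⟨ ∑-fixAt φ ⟩
    ∑[ i < n ] φ i (s i) + φ k n      ∎

  k≮k : (k <ᵇ k) ≡ false
  k≮k = <ᵇ-false (≤-refl {k})

  displacement-step : displacement (suc n) f ≡ displacement n s + ((n ∸ k) + (n ∸ k))
  displacement-step = begin
    displacement (suc n) f
      ≡⟨ ∑-init-last n _ ⟩
    displacement n f + ∣ k - n ∣
      ≡⟨ cong₂ _+_ (∑-fixAt′ (λ i x → ∣ x - i ∣) (∣n-n∣≡0 k)) (m≤n⇒∣m-n∣≡n∸m (<⇒≤ k<n)) ⟩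
    displacement n s + ∣ n - k ∣ + (n ∸ k)
      ≡⟨ cong (λ x → displacement n s + x + (n ∸ k)) (m≤n⇒∣n-m∣≡n∸m (<⇒≤ k<n)) ⟩
    displacement n s + (n ∸ k) + (n ∸ k)
      ≡⟨ +-assoc (displacement n s) _ _ ⟩
    displacement n s + ((n ∸ k) + (n ∸ k)) ∎

  transpositions-step : transpositions (suc n) f ≡ suc (transpositions n s)
  transpositions-step = begin
    transpositions (suc n) f
      ≡⟨ ∑-init-last n _ ⟩
    transpositions n f + 𝟙 (k <ᵇ n)
      ≡⟨ cong₂ (λ x b → x + 𝟙 b) (∑-fixAt′ (λ i x → 𝟙 (x <ᵇ i)) (cong 𝟙 k≮k)) (<ᵇ-true k<n) ⟩
    transpositions n s + 𝟙 (n <ᵇ k) + 1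
      ≡⟨ cong (λ b → transpositions n s + 𝟙 b + 1) (<ᵇ-false (<⇒≤ k<n)) ⟩
    transpositions n s + 0 + 1
      ≡⟨ cong (_+ 1) (+-identityʳ _) ⟩
    transpositions n s + 1
      ≡⟨ +-comm _ 1 ⟩
    suc (transpositions n s) ∎

  values-above-k : ∑[ i < n ] 𝟙 (k <ᵇ f i) ≡ n ∸ k
  values-above-k = begin
    ∑[ i < n ] 𝟙 (k <ᵇ f i)
      ≡⟨ ∑-fixAt′ (λ _ x → 𝟙 (k <ᵇ x)) (cong 𝟙 k≮k) ⟩
    ∑[ i < n ] 𝟙 (k <ᵇ s i) + 𝟙 (k <ᵇ n)
      ≡⟨ cong₂ (λ x b → x + 𝟙 b) (∑-reindex n s s-involution (λ x → 𝟙 (k <ᵇ x))) (<ᵇ-true k<n) ⟩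
    ∑[ i < n ] 𝟙 (k <ᵇ i) + 1
      ≡⟨ cong (_+ 1) (∑-count-above n k) ⟩
    n ∸ suc k + 1
      ≡⟨ +-comm _ 1 ⟩
    suc (n ∸ suc k)
      ≡⟨ +-∸-assoc 1 k<n ⟨
    n ∸ k ∎

  cross-f : cross n (inversion f) k ≡ n ∸ suc k
  cross-f = begin
    ∑< n (inversion f k) + ∑[ i < n ] inversion f i k ≡⟨ cong₂ _+_ (∑-cong n row) (∑-zero n column) ⟩
    ∑[ j < n ] 𝟙 (k <ᵇ j) + 0                      ≡⟨ cong (_+ 0) (∑-count-above n k) ⟩
    n ∸ suc k + 0                                  ≡⟨ +-identityʳ _ ⟩
    n ∸ suc k                                      ∎
    where
    row : ∀ j → j < n → inversion f k j ≡ 𝟙 (k <ᵇ j)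
    row j j<n with j ≟ k
    ... | yes refl rewrite k≮k = refl
    ... | no j≢k rewrite f-k | <ᵇ-true (involution-below n f inv j<n j≢k) | ∧-identityʳ (k <ᵇ j) = refl
    column : ∀ i → i < n → inversion f i k ≡ 0
    column i i<n rewrite f-k | <ᵇ-false (s≤s⁻¹ (proj₁ (inv i (m<n⇒m<1+n i<n)))) | ∧-zeroʳ (i <ᵇ k) = refl

  inversions-step : inversions (suc n) f + cross n (inversion s) k ≡ inversions n s + (n ∸ suc k) + (n ∸ k)
  inversions-step = begin
    inversions (suc n) f + cross n (inversion s) k
      ≡⟨ cong (_+ cross n (inversion s) k) (inversions-init-last n f) ⟩
    inversions n f + ∑[ i < n ] 𝟙 (k <ᵇ f i) + cross n (inversion s) k
      ≡⟨ cong (λ x → inversions n f + x + cross n (inversion s) k) values-above-k ⟩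
    inversions n f + (n ∸ k) + cross n (inversion s) k
      ≡⟨ xy∙z≈xz∙y (inversions n f) _ _ ⟩
    inversions n f + cross n (inversion s) k + (n ∸ k)
      ≡⟨ cong (_+ (n ∸ k)) (∑∑-exchange n k (inversion f) (inversion s) k<n diagonal off-k) ⟩
    inversions n s + cross n (inversion f) k + (n ∸ k)
      ≡⟨ cong (λ x → inversions n s + x + (n ∸ k)) cross-f ⟩
    inversions n s + (n ∸ suc k) + (n ∸ k) ∎
    where
    diagonal : inversion f k k ≡ inversion s k k
    diagonal rewrite k≮k = refl
    off-k : ∀ i j → i < n → j < n → i ≢ k → j ≢ k → inversion f i j ≡ inversion s i j
    off-k i j _ _ i≢k j≢k rewrite fixAt-≢ k f i≢k | fixAt-≢ k f j≢k = refl

  inversions+transpositions-step :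
    inversions (suc n) f + transpositions (suc n) f + cross n (inversion s) k ≡
    inversions n s + transpositions n s + ((n ∸ k) + (n ∸ k))
  inversions+transpositions-step = begin
    inversions (suc n) f + transpositions (suc n) f + cross n (inversion s) k
      ≡⟨ xy∙z≈xz∙y (inversions (suc n) f) _ _ ⟩
    inversions (suc n) f + cross n (inversion s) k + transpositions (suc n) f
      ≡⟨ cong₂ _+_ inversions-step transpositions-step ⟩
    inversions n s + (n ∸ suc k) + (n ∸ k) + suc (transpositions n s)
      ≡⟨ regroup (inversions n s) (n ∸ suc k) (n ∸ k) (transpositions n s) ⟩
    inversions n s + transpositions n s + (suc (n ∸ suc k) + (n ∸ k))
      ≡⟨ cong (λ x → inversions n s + transpositions n s + (x + (n ∸ k))) (+-∸-assoc 1 k<n) ⟨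
    inversions n s + transpositions n s + ((n ∸ k) + (n ∸ k)) ∎
    where
    regroup : ∀ a b c d → a + b + c + suc d ≡ a + d + (suc b + c)
    regroup = solve-∀

  bound-step : inversions n s + transpositions n s ≤ displacement n s →
               inversions (suc n) f + transpositions (suc n) f + cross n (inversion s) k ≤ displacement (suc n) f
  bound-step bound-s = subst₂ _≤_ (sym inversions+transpositions-step) (sym displacement-step)
    (+-monoˡ-≤ ((n ∸ k) + (n ∸ k)) bound-s)

module FixedLast {n : ℕ} {f : ℕ → ℕ} (inv : Involution (suc n) f) (fn≡n : f n ≡ n) where
  open ≡-Reasoning

  displacement-fixed : displacement (suc n) f ≡ displacement n f
  displacement-fixed = begin
    displacement (suc n) f         ≡⟨ ∑-init-last n _ ⟩
    displacement n f + ∣ f n - n ∣ ≡⟨ cong (λ x → displacement n f + ∣ x - n ∣) fn≡n ⟩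
    displacement n f + ∣ n - n ∣   ≡⟨ cong (displacement n f +_) (∣n-n∣≡0 n) ⟩
    displacement n f + 0           ≡⟨ +-identityʳ _ ⟩
    displacement n f               ∎

  inversions+transpositions-fixed :
    inversions (suc n) f + transpositions (suc n) f ≡ inversions n f + transpositions n f
  inversions+transpositions-fixed = cong₂ _+_ inversions-fixed transpositions-fixed
    where
    inversions-fixed : inversions (suc n) f ≡ inversions n f
    inversions-fixed = begin
      inversions (suc n) f                        ≡⟨ inversions-init-last n f ⟩
      inversions n f + ∑[ i < n ] 𝟙 (f n <ᵇ f i) ≡⟨ cong (inversions n f +_) (∑-zero n none-above) ⟩
      inversions n f + 0                          ≡⟨ +-identityʳ _ ⟩
      inversions n f                              ∎
      where
      none-above : ∀ i → i < n → 𝟙 (f n <ᵇ f i) ≡ 0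
      none-above i i<n rewrite fn≡n | <ᵇ-false (<⇒≤ (proj₁ (involution-restrict n f inv fn≡n i i<n))) = refl
    transpositions-fixed : transpositions (suc n) f ≡ transpositions n f
    transpositions-fixed = begin
      transpositions (suc n) f          ≡⟨ ∑-init-last n _ ⟩
      transpositions n f + 𝟙 (f n <ᵇ n) ≡⟨ cong (λ x → transpositions n f + 𝟙 (x <ᵇ n)) fn≡n ⟩
      transpositions n f + 𝟙 (n <ᵇ n)   ≡⟨ cong (λ b → transpositions n f + 𝟙 b) (<ᵇ-false (≤-refl {n})) ⟩
      transpositions n f + 0            ≡⟨ +-identityʳ _ ⟩
      transpositions n f                ∎

  shallow-fixed : Shallow (suc n) f ⇔ Shallow n f
  shallow-fixed = mk⇔
    (λ sh → trans (sym inversions+transpositions-fixed) (trans sh displacement-fixed))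
    (λ sh → trans inversions+transpositions-fixed (trans sh (sym displacement-fixed)))

inversions+transpositions≤displacement :
  ∀ n f → Involution n f → inversions n f + transpositions n f ≤ displacement n f
inversions+transpositions≤displacement zero    f inv = z≤n
inversions+transpositions≤displacement (suc n) f inv with m<1+n⇒m<n∨m≡n (proj₁ (inv n ≤-refl))
... | inj₂ fn≡n = subst₂ _≤_ (sym inversions+transpositions-fixed) (sym displacement-fixed)
                    (inversions+transpositions≤displacement n f (involution-restrict n f inv fn≡n))
  where open FixedLast inv fn≡n
... | inj₁ k<n = ≤-trans (m≤m+n _ _) (bound-step (inversions+transpositions≤displacement n s s-involution))
  where open TwoCycleStatistics inv k<n

moved-last-is-zero : ∀ n f → IsShallowInv132 (suc n) f → f n < n → f n ≡ 0
moved-last-is-zero n f (inv , avoids , shallow) k<n with f n ≟ 0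
... | yes k≡0 = k≡0
... | no  k≢0 = ⊥-elim (compare-f0 (<-cmp (f 0) k))
  where
  open TwoCycleStatistics inv k<n

  0<k : 0 < k
  0<k = n≢0⇒n>0 k≢0

  cross-vanishes : cross n (inversion s) k ≡ 0
  cross-vanishes = n≤0⇒n≡0 (+-cancelˡ-≤ (inversions (suc n) f + transpositions (suc n) f) _ 0 (begin
    inversions (suc n) f + transpositions (suc n) f + cross n (inversion s) k
      ≤⟨ bound-step (inversions+transpositions≤displacement n s s-involution) ⟩
    displacement (suc n) f                              ≡⟨ shallow ⟨
    inversions (suc n) f + transpositions (suc n) f     ≡⟨ +-identityʳ _ ⟨
    inversions (suc n) f + transpositions (suc n) f + 0 ∎))
    where open ≤-Reasoning

  compare-f0 : Tri (f 0 < k) (f 0 ≡ k) (k < f 0) → ⊥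
  compare-f0 (tri< f0<k _ _) = avoids 0 k n ≤-refl (0<k , k<n , f0<k , subst (k <_) (sym f-k) k<n)
  compare-f0 (tri≈ _ f0≡k _) = n≮0 (subst (k <_) n≡0 k<n)
    where
    n≡0 : n ≡ 0
    n≡0 = trans (sym f-k) (trans (cong f (sym f0≡k)) (proj₂ (inv 0 z<s)))
  compare-f0 (tri> _ _ k<f0) = 1+n≰n (begin
    1                                 ≡⟨ inversion-0k ⟨
    inversion s 0 k                   ≤⟨ ∑-term-≤ n 0 (λ i → inversion s i k) (<-trans 0<k k<n) ⟩
    ∑[ i < n ] inversion s i k        ≤⟨ m≤n+m _ _ ⟩
    cross n (inversion s) k           ≡⟨ cross-vanishes ⟩
    0                                 ∎)
    where
    open ≤-Reasoning
    inversion-0k : inversion s 0 k ≡ 1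
    inversion-0k rewrite fixAt-≡ k f | fixAt-≢ k f {0} (≢-sym k≢0) | <ᵇ-true 0<k | <ᵇ-true k<f0 = refl

-- Adding a fixed point, or a 2-cycle around everything

IsShallowInv132-cong : ∀ n f g → Agree n f g → IsShallowInv132 n f → IsShallowInv132 n g
IsShallowInv132-cong n f g f≗g (inv , avoids , shallow) = involution , avoids′ , shallow′
  where
  open ≡-Reasoning
  involution : Involution n g
  involution i i<n = subst (_< n) (f≗g i i<n) fi<n , (begin
    g (g i) ≡⟨ cong g (f≗g i i<n) ⟨
    g (f i) ≡⟨ f≗g (f i) fi<n ⟨
    f (f i) ≡⟨ proj₂ (inv i i<n) ⟩
    i       ∎)
    where
    fi<n : f i < n
    fi<n = proj₁ (inv i i<n)
  avoids′ : Avoids132 n g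
  avoids′ i j k k<n (i<j , j<k , gi<gk , gk<gj) = avoids i j k k<n (i<j , j<k ,
    subst₂ _<_ (sym (f≗g i (<-trans i<j (<-trans j<k k<n)))) (sym (f≗g k k<n)) gi<gk ,
    subst₂ _<_ (sym (f≗g k k<n)) (sym (f≗g j (<-trans j<k k<n))) gk<gj)
  shallow′ : Shallow n g
  shallow′ = begin
    inversions n g + transpositions n g ≡⟨ cong₂ _+_ inversions≡ transpositions≡ ⟨
    inversions n f + transpositions n f ≡⟨ shallow ⟩
    displacement n f                    ≡⟨ ∑-cong n (λ i i<n → cong (λ x → ∣ x - i ∣) (f≗g i i<n)) ⟩
    displacement n g                    ∎
    where
    inversions≡ : inversions n f ≡ inversions n g
    inversions≡ = ∑-cong n (λ i i<n → ∑-cong n (λ j j<n →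
      cong₂ (λ x y → 𝟙 ((i <ᵇ j) ∧ (x <ᵇ y))) (f≗g j j<n) (f≗g i i<n)))
    transpositions≡ : transpositions n f ≡ transpositions n g
    transpositions≡ = ∑-cong n (λ i i<n → cong (λ x → 𝟙 (x <ᵇ i)) (f≗g i i<n))

IsShallowInv132-fixed-last : ∀ n f → f n ≡ n → IsShallowInv132 (suc n) f ⇔ IsShallowInv132 n f
IsShallowInv132-fixed-last n f fn≡n = mk⇔ restrict extend
  where
  restrict : IsShallowInv132 (suc n) f → IsShallowInv132 n f
  restrict (inv , avoids , shallow) =
    involution-restrict n f inv fn≡n ,
    (λ i j k k<n → avoids i j k (m<n⇒m<1+n k<n)) ,
    Equivalence.to (FixedLast.shallow-fixed inv fn≡n) shallow
  extend : IsShallowInv132 n f → IsShallowInv132 (suc n) f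
  extend (inv , avoids , shallow) =
    involution , avoids′ , Equivalence.from (FixedLast.shallow-fixed involution fn≡n) shallow
    where
    involution : Involution (suc n) f
    involution i i<1+n with m<1+n⇒m<n∨m≡n i<1+n
    ... | inj₁ i<n  = m<n⇒m<1+n (proj₁ (inv i i<n)) , proj₂ (inv i i<n)
    ... | inj₂ refl = subst (_< suc i) (sym fn≡n) ≤-refl , trans (cong f fn≡n) fn≡n
    avoids′ : Avoids132 (suc n) f
    avoids′ i j k k<1+n p@(_ , j<k , _ , fk<fj) with m<1+n⇒m<n∨m≡n k<1+n
    ... | inj₁ k<n  = avoids i j k k<n p
    ... | inj₂ refl = <⇒≱ (subst (_< f j) fn≡n fk<fj) (<⇒≤ (proj₁ (inv j j<k)))

fixAt-agree : ∀ n g → Agree n (fixAt n g) g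
fixAt-agree n g i i<n = fixAt-≢ n g (<⇒≢ i<n)

IsShallowInv132-fixAt : ∀ n g → IsShallowInv132 n g → IsShallowInv132 (suc n) (fixAt n g)
IsShallowInv132-fixAt n g valid-g = Equivalence.from (IsShallowInv132-fixed-last n (fixAt n g) (fixAt-≡ n g))
  (IsShallowInv132-cong n g (fixAt n g) (λ i i<n → sym (fixAt-agree n g i i<n)) valid-g)

fixAt-cong : ∀ n g h → Agree n g h → h n ≡ n → Agree (suc n) (fixAt n g) h
fixAt-cong n g h g≗h hn≡n i i<1+n with m<1+n⇒m<n∨m≡n i<1+n
... | inj₂ refl = trans (fixAt-≡ n g) (sym hn≡n)
... | inj₁ i<n  = trans (fixAt-agree n g i i<n) (g≗h i i<n)

-- In one-line notation: (n+2) (g₁+1) ⋯ (gₙ+1) 1, shifted down by one.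
wrap : ℕ → (ℕ → ℕ) → ℕ → ℕ
wrap n g zero    = suc n
wrap n g (suc i) = if i ≡ᵇ n then 0 else suc (g i)

wrap-last : ∀ n g → wrap n g (suc n) ≡ 0
wrap-last n g rewrite ≡ᵇ-true n = refl

wrap-suc : ∀ n g {i} → i < n → wrap n g (suc i) ≡ suc (g i)
wrap-suc n g i<n rewrite ≡ᵇ-false (<⇒≢ i<n) = refl

∑-wrap : ∀ n g (φ : ℕ → ℕ → ℕ) →
         ∑[ i < suc (suc n) ] φ i (wrap n g i) ≡ φ 0 (suc n) + (∑[ i < n ] φ (suc i) (suc (g i)) + φ (suc n) 0)
∑-wrap n g φ = cong (φ 0 (suc n) +_) (trans (∑-init-last n _) (cong₂ _+_
  (∑-cong n (λ i i<n → cong (φ (suc i)) (wrap-suc n g i<n))) (cong (φ (suc n)) (wrap-last n g))))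

module Wrap (n : ℕ) (g : ℕ → ℕ) (inv : Involution n g) where
  open ≡-Reasoning

  w : ℕ → ℕ
  w = wrap n g

  involution : Involution (suc (suc n)) w
  involution zero    _       = ≤-refl , wrap-last n g
  involution (suc i) 1+i<2+n with m<1+n⇒m<n∨m≡n (s<s⁻¹ 1+i<2+n)
  ... | inj₂ refl = subst (_< suc (suc i)) (sym (wrap-last i g)) z<s , cong w (wrap-last i g)
  ... | inj₁ i<n  = subst (_< suc (suc n)) (sym (wrap-suc n g i<n)) (s<s (m<n⇒m<1+n gi<n)) , (begin
    w (w (suc i))     ≡⟨ cong w (wrap-suc n g i<n) ⟩
    w (suc (g i))     ≡⟨ wrap-suc n g gi<n ⟩
    suc (g (g i))     ≡⟨ cong suc (proj₂ (inv i i<n)) ⟩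
    suc i             ∎)
    where
    gi<n : g i < n
    gi<n = proj₁ (inv i i<n)

  avoids : Avoids132 n g → Avoids132 (suc (suc n)) w
  avoids av zero    j       k       k<2+n (_ , _ , w0<wk , _) = <⇒≱ w0<wk (s≤s⁻¹ (proj₁ (involution k k<2+n)))
  avoids av (suc i) zero    _       _     (() , _)
  avoids av (suc i) (suc j) zero    _     (_ , () , _)
  avoids av (suc i) (suc j) (suc k) 1+k<2+n (1+i<1+j , 1+j<1+k , wi<wk , wk<wj)
    with m<1+n⇒m<n∨m≡n (s<s⁻¹ 1+k<2+n)
  ... | inj₂ refl = n≮0 (subst (w (suc i) <_) (wrap-last k g) wi<wk)
  ... | inj₁ k<n  = av i j k k<n (s<s⁻¹ 1+i<1+j , s<s⁻¹ 1+j<1+k ,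
    s<s⁻¹ (subst₂ _<_ (wrap-suc n g i<n) (wrap-suc n g k<n) wi<wk) ,
    s<s⁻¹ (subst₂ _<_ (wrap-suc n g k<n) (wrap-suc n g j<n) wk<wj))
    where
    j<n : j < n
    j<n = <-trans (s<s⁻¹ 1+j<1+k) k<n
    i<n : i < n
    i<n = <-trans (s<s⁻¹ 1+i<1+j) j<n

  displacement-wrap : displacement (suc (suc n)) w ≡ displacement n g + (suc n + suc n)
  displacement-wrap = begin
    displacement (suc (suc n)) w              ≡⟨ ∑-wrap n g (λ i x → ∣ x - i ∣) ⟩
    suc n + (displacement n g + suc n)        ≡⟨ x∙yz≈y∙xz (suc n) _ _ ⟩
    displacement n g + (suc n + suc n)        ∎

  transpositions-wrap : transpositions (suc (suc n)) w ≡ transpositions n g + 1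
  transpositions-wrap = ∑-wrap n g (λ i x → 𝟙 (x <ᵇ i))

  inversions-wrap : inversions (suc (suc n)) w ≡ suc n + (inversions n g + n)
  inversions-wrap = begin
    inversions (suc (suc n)) w
      ≡⟨ cong (R 0 +_) (∑-init-last n (R ∘ suc)) ⟩
    R 0 + (∑[ i < n ] R (suc i) + R (suc n))
      ≡⟨ cong₂ (λ x y → x + (y + R (suc n))) first-row (∑-cong n middle-row) ⟩
    suc n + (∑[ i < n ] (∑< n (inversion g i) + 1) + R (suc n))
      ≡⟨ cong₂ (λ x y → suc n + (x + y)) (∑-distrib-+ n _ _) (∑-zero (suc (suc n)) last-row) ⟩
    suc n + (inversions n g + ∑[ i < n ] 1 + 0)
      ≡⟨ cong (λ x → suc n + (inversions n g + x + 0)) (trans (∑-const n 1) (*-identityʳ n)) ⟩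
    suc n + (inversions n g + n + 0)
      ≡⟨ cong (suc n +_) (+-identityʳ _) ⟩
    suc n + (inversions n g + n) ∎
    where
    R : ℕ → ℕ
    R i = ∑< (suc (suc n)) (inversion w i)
    first-row : R 0 ≡ suc n
    first-row = begin
      R 0
        ≡⟨ ∑-wrap n g (λ j x → 𝟙 ((0 <ᵇ j) ∧ (x <ᵇ suc n))) ⟩
      ∑[ j < n ] 𝟙 (g j <ᵇ n) + 1
        ≡⟨ cong (_+ 1) (∑-cong n (λ j j<n → cong 𝟙 (<ᵇ-true (proj₁ (inv j j<n))))) ⟩
      ∑[ j < n ] 1 + 1
        ≡⟨ cong (_+ 1) (trans (∑-const n 1) (*-identityʳ n)) ⟩
      n + 1
        ≡⟨ +-comm n 1 ⟩
      suc n ∎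
    middle-row : ∀ i → i < n → R (suc i) ≡ ∑< n (inversion g i) + 1
    middle-row i i<n = begin
      R (suc i)
        ≡⟨ ∑-wrap n g (λ j x → 𝟙 ((suc i <ᵇ j) ∧ (x <ᵇ w (suc i)))) ⟩
      ∑[ j < n ] 𝟙 ((i <ᵇ j) ∧ (suc (g j) <ᵇ w (suc i))) + 𝟙 ((i <ᵇ n) ∧ (0 <ᵇ w (suc i)))
        ≡⟨ cong (λ x → ∑[ j < n ] 𝟙 ((i <ᵇ j) ∧ (suc (g j) <ᵇ x)) + 𝟙 ((i <ᵇ n) ∧ (0 <ᵇ x))) (wrap-suc n g i<n) ⟩
      ∑< n (inversion g i) + 𝟙 ((i <ᵇ n) ∧ true)
        ≡⟨ cong (λ b → ∑< n (inversion g i) + 𝟙 (b ∧ true)) (<ᵇ-true i<n) ⟩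
      ∑< n (inversion g i) + 1 ∎
    last-row : ∀ j → j < suc (suc n) → inversion w (suc n) j ≡ 0
    last-row j j<2+n rewrite <ᵇ-false (s≤s⁻¹ j<2+n) = refl

  inversions+transpositions-wrap :
    inversions (suc (suc n)) w + transpositions (suc (suc n)) w ≡
    inversions n g + transpositions n g + (suc n + suc n)
  inversions+transpositions-wrap = trans (cong₂ _+_ inversions-wrap transpositions-wrap)
    (regroup (suc n) (inversions n g) n (transpositions n g))
    where
    regroup : ∀ a b c d → a + (b + c) + (d + 1) ≡ b + d + (a + suc c)
    regroup = solve-∀

  shallow-wrap : Shallow n g ⇔ Shallow (suc (suc n)) w
  shallow-wrap = mk⇔
    (λ sh → trans inversions+transpositions-wrap (trans (cong (_+ (suc n + suc n)) sh) (sym displacement-wrap)))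
    (λ sh → +-cancelʳ-≡ (suc n + suc n) _ _
      (trans (sym inversions+transpositions-wrap) (trans sh displacement-wrap)))

IsShallowInv132-wrap : ∀ n g → IsShallowInv132 n g → IsShallowInv132 (suc (suc n)) (wrap n g)
IsShallowInv132-wrap n g (inv , av , sh) = involution , avoids av , Equivalence.to shallow-wrap sh
  where open Wrap n g inv

unwrap : (ℕ → ℕ) → ℕ → ℕ
unwrap h i = pred (h (suc i))

unwrap-wrap : ∀ n g → Agree n (unwrap (wrap n g)) g
unwrap-wrap n g i i<n = cong pred (wrap-suc n g i<n)

wrap-cong : ∀ n g h → Agree n g h → Agree (suc (suc n)) (wrap n g) (wrap n h)
wrap-cong n g h g≗h zero    _       = refl
wrap-cong n g h g≗h (suc i) 1+i<2+n with m<1+n⇒m<n∨m≡n (s<s⁻¹ 1+i<2+n)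
... | inj₂ refl = trans (wrap-last i g) (sym (wrap-last i h))
... | inj₁ i<n  = trans (wrap-suc n g i<n) (trans (cong suc (g≗h i i<n)) (sym (wrap-suc n h i<n)))

module Unwrap {n : ℕ} {h : ℕ → ℕ} (inv : Involution (suc (suc n)) h) (last≡0 : h (suc n) ≡ 0) where
  open ≡-Reasoning

  g : ℕ → ℕ
  g = unwrap h

  1+i<2+n : ∀ {i} → i < n → suc i < suc (suc n)
  1+i<2+n i<n = s<s (m<n⇒m<1+n i<n)

  h-0 : h 0 ≡ suc n
  h-0 = trans (cong h (sym last≡0)) (proj₂ (inv (suc n) ≤-refl))

  h-suc : ∀ i → i < n → h (suc i) ≡ suc (g i)
  h-suc i i<n = sym (suc-pred (h (suc i)) {{≢-nonZero h-suc≢0}})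
    where
    h-suc≢0 : h (suc i) ≢ 0
    h-suc≢0 hi≡0 = <⇒≢ i<n (suc-injective
      (involution-injective _ h inv (1+i<2+n i<n) ≤-refl (trans hi≡0 (sym last≡0))))

  wrap-unwrap : Agree (suc (suc n)) h (wrap n g)
  wrap-unwrap zero    _       = h-0
  wrap-unwrap (suc i) 1+i<2+n with m<1+n⇒m<n∨m≡n (s<s⁻¹ 1+i<2+n)
  ... | inj₂ refl = trans last≡0 (sym (wrap-last i g))
  ... | inj₁ i<n  = trans (h-suc i i<n) (sym (wrap-suc n g i<n))

  g<n : ∀ i → i < n → g i < n
  g<n i i<n = ≤∧≢⇒< (s≤s⁻¹ (s<s⁻¹ g1+i<2+n)) gi≢n
    where
    g1+i<2+n : suc (g i) < suc (suc n)
    g1+i<2+n = subst (_< suc (suc n)) (h-suc i i<n) (proj₁ (inv (suc i) (1+i<2+n i<n)))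
    gi≢n : g i ≢ n
    gi≢n gi≡n = 0≢1+n (sym (involution-injective _ h inv (1+i<2+n i<n) z<s
                   (trans (h-suc i i<n) (trans (cong suc gi≡n) (sym h-0)))))

  involution : Involution n g
  involution i i<n = g<n i i<n , (begin
    pred (h (suc (g i))) ≡⟨ cong (pred ∘ h) (h-suc i i<n) ⟨
    pred (h (h (suc i))) ≡⟨ cong pred (proj₂ (inv (suc i) (1+i<2+n i<n))) ⟩
    i                    ∎)

  avoids : Avoids132 (suc (suc n)) h → Avoids132 n g
  avoids av i j k k<n (i<j , j<k , gi<gk , gk<gj) = av (suc i) (suc j) (suc k) (1+i<2+n k<n)
    (s<s i<j , s<s j<k ,
    subst₂ _<_ (sym (h-suc i (<-trans i<j (<-trans j<k k<n)))) (sym (h-suc k k<n)) (s<s gi<gk) ,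
    subst₂ _<_ (sym (h-suc k k<n)) (sym (h-suc j (<-trans j<k k<n))) (s<s gk<gj))

IsShallowInv132-unwrap : ∀ n h → IsShallowInv132 (suc (suc n)) h → h (suc n) ≡ 0 → IsShallowInv132 n (unwrap h)
IsShallowInv132-unwrap n h valid-h@(inv , av , _) last≡0 =
  involution , avoids av , Equivalence.from (Wrap.shallow-wrap n (unwrap h) involution) shallow-wrapped
  where
  open Unwrap inv last≡0
  shallow-wrapped : Shallow (suc (suc n)) (wrap n (unwrap h))
  shallow-wrapped = proj₂ (proj₂ (IsShallowInv132-cong _ h (wrap n (unwrap h)) wrap-unwrap valid-h))

-- Words in one-line notation

-- Positions beyond the length are sent to the junk value 0.
toFun : ∀ {m n} → Vec (Fin m) n → ℕ → ℕ
toFun []       _       = 0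
toFun (x ∷ xs) zero    = toℕ x
toFun (x ∷ xs) (suc i) = toFun xs i

toFun-lookup : ∀ {m n} (v : Vec (Fin m) n) i → toFun v (toℕ i) ≡ toℕ (lookup v i)
toFun-lookup (x ∷ xs) Fin.zero    = refl
toFun-lookup (x ∷ xs) (Fin.suc i) = toFun-lookup xs i

toFun-< : ∀ {m n} (v : Vec (Fin m) n) i → i < n → toFun v i < m
toFun-< (x ∷ xs) zero    _         = toℕ<n x
toFun-< (x ∷ xs) (suc i) (s<s i<n) = toFun-< xs i i<n

toFun-injective : ∀ {m n} (v w : Vec (Fin m) n) → Agree n (toFun v) (toFun w) → v ≡ w
toFun-injective []       []       _  = refl
toFun-injective (x ∷ xs) (y ∷ ys) eq =
  cong₂ _∷_ (toℕ-injective (eq 0 z<s)) (toFun-injective xs ys (λ i i<n → eq (suc i) (s<s i<n)))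

fromFun : ∀ n → (ℕ → ℕ) → Vec (Fin n) n
fromFun n g = tabulate (λ i → (g (toℕ i) mod n) {{nonZeroIndex i}})

toFun-fromFun : ∀ n g → .(∀ i → i < n → g i < n) → Agree n (toFun (fromFun n g)) g
toFun-fromFun n g g<n i i<n = begin
  toFun (fromFun n g) i            ≡⟨ cong (toFun (fromFun n g)) (toℕ-fromℕ< i<n) ⟨
  toFun (fromFun n g) (toℕ j)      ≡⟨ toFun-lookup (fromFun n g) j ⟩
  toℕ (lookup (fromFun n g) j)     ≡⟨ cong toℕ (lookup∘tabulate _ j) ⟩
  toℕ (g (toℕ j) mod n)            ≡⟨ toℕ-fromℕ< _ ⟩
  g (toℕ j) % n                    ≡⟨ cong (λ x → g x % n) (toℕ-fromℕ< i<n) ⟩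
  g i % n                          ≡⟨ m<n⇒m%n≡m (recompute (g i <? n) (g<n i i<n)) ⟩
  g i                              ∎
  where
  open ≡-Reasoning
  j : Fin n
  j = fromℕ< i<n
  instance
    n≢0 : NonZero n
    n≢0 = nonZeroIndex j

T-all-allFin : ∀ {n} (p : Fin n → Bool) → T (all p (allFin n)) ⇔ (∀ i → T (p i))
T-all-allFin p = mk⇔ (λ t → All.tabulate⁻ (all⁺ p _ t)) (λ ps → all⁻ p (All.tabulate⁺ ps))

T-any-allFin : ∀ {n} (p : Fin n → Bool) → T (any p (allFin n)) ⇔ Σ (Fin n) (T ∘ p)
T-any-allFin p = mk⇔ (λ t → Any.tabulate⁻ (any⁻ p _ t)) (λ (i , t) → any⁺ p (Any.tabulate⁺ i t))

sum-allFin : ∀ n {H : Fin n → ℕ} {h} → (∀ i → H i ≡ h (toℕ i)) → sum (map H (allFin n)) ≡ ∑< n h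
sum-allFin n {H} eq = trans (cong sum (map-tabulate id H)) (sum-tabulate n eq)
  where
  sum-tabulate : ∀ n {F : Fin n → ℕ} {h} → (∀ i → F i ≡ h (toℕ i)) → sum (tabulateᴸ F) ≡ ∑< n h
  sum-tabulate zero    eq = refl
  sum-tabulate (suc n) eq = cong₂ _+_ (eq Fin.zero) (sum-tabulate n (eq ∘ Fin.suc))

iter-involution : ∀ {A : Set} (π : A → A) x → π (π x) ≡ x → ∀ k → iter π k x ≡ x ⊎ iter π k x ≡ π x
iter-involution π x ππx≡x zero    = inj₁ refl
iter-involution π x ππx≡x (suc k) with iter-involution π x ππx≡x k
... | inj₁ πᵏx≡x  = inj₂ (cong π πᵏx≡x)
... | inj₂ πᵏx≡πx = inj₁ (trans (cong π πᵏx≡πx) ππx≡x)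

weakExcedances : ℕ → (ℕ → ℕ) → ℕ
weakExcedances n f = ∑[ i < n ] 𝟙 (i ≤ᵇ f i)

weakExcedances+transpositions : ∀ n f → weakExcedances n f + transpositions n f ≡ n
weakExcedances+transpositions n f = begin
  weakExcedances n f + transpositions n f
    ≡⟨ ∑-distrib-+ n _ _ ⟨
  ∑[ i < n ] (𝟙 (i ≤ᵇ f i) + 𝟙 (f i <ᵇ i))
    ≡⟨ ∑-cong n (λ i _ → trans (cong (λ b → 𝟙 b + 𝟙 (f i <ᵇ i)) (≤ᵇ≡not<ᵇ i (f i))) (𝟙-not (f i <ᵇ i))) ⟩
  ∑[ i < n ] 1
    ≡⟨ ∑-const n 1 ⟩
  n * 1
    ≡⟨ *-identityʳ n ⟩
  n ∎
  where open ≡-Reasoning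

module Word {n : ℕ} (v : Vec (Fin n) n) where
  open ≡-Reasoning

  f : ℕ → ℕ
  f = toFun v

  val≡f : ∀ i → Defs.val v i ≡ f (toℕ i)
  val≡f i = sym (toFun-lookup v i)

  f∘f : ∀ i → f (f (toℕ i)) ≡ toℕ (lookup v (lookup v i))
  f∘f i = trans (cong f (toFun-lookup v i)) (toFun-lookup v (lookup v i))

  involution⇔ : T (Defs.isInvolution v) ⇔ Involution n f
  involution⇔ = mk⇔
    (λ t i i<n → toFun-< v i i<n , subst (λ x → f (f x) ≡ x) (toℕ-fromℕ< i<n)
      (trans (f∘f (fromℕ< i<n)) (≡ᵇ⇒≡ _ _ (Equivalence.to (T-all-allFin _) t (fromℕ< i<n)))))
    (λ inv → Equivalence.from (T-all-allFin _) (λ i →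
      ≡⇒≡ᵇ _ _ (trans (sym (f∘f i)) (proj₂ (inv (toℕ i) (toℕ<n i))))))

  pattern⇔ : ∀ i j k →
    T ((toℕ i <ᵇ toℕ j) ∧ (toℕ j <ᵇ toℕ k) ∧ (Defs.val v i <ᵇ Defs.val v k) ∧ (Defs.val v k <ᵇ Defs.val v j)) ⇔
    Pattern132 f (toℕ i) (toℕ j) (toℕ k)
  pattern⇔ i j k = mk⇔
    (λ t → let t₁ , t₂ = Equivalence.to T-∧ t ; t₂ , t₃ = Equivalence.to T-∧ t₂ ; t₃ , t₄ = Equivalence.to T-∧ t₃
           in <ᵇ⇒< _ _ t₁ , <ᵇ⇒< _ _ t₂ ,
              subst₂ _<_ (val≡f i) (val≡f k) (<ᵇ⇒< _ _ t₃) , subst₂ _<_ (val≡f k) (val≡f j) (<ᵇ⇒< _ _ t₄))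
    (λ (i<j , j<k , fi<fk , fk<fj) → Equivalence.from T-∧ (<⇒<ᵇ i<j , Equivalence.from T-∧ (<⇒<ᵇ j<k ,
      Equivalence.from T-∧ (<⇒<ᵇ (subst₂ _<_ (sym (val≡f i)) (sym (val≡f k)) fi<fk) ,
                            <⇒<ᵇ (subst₂ _<_ (sym (val≡f k)) (sym (val≡f j)) fk<fj)))))

  avoids⇔ : T (Defs.avoids132 v) ⇔ Avoids132 n f
  avoids⇔ = mk⇔ to from
    where
    no-pattern : T (Defs.avoids132 v) → ∀ i j k → ¬ Pattern132 f (toℕ i) (toℕ j) (toℕ k)
    no-pattern t i j k p = T-not⁻ t (Equivalence.from (T-any-allFin _) (i , Equivalence.from (T-any-allFin _)
      (j , Equivalence.from (T-any-allFin _) (k , Equivalence.from (pattern⇔ i j k) p))))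
    to : T (Defs.avoids132 v) → Avoids132 n f
    to t i j k k<n p@(i<j , j<k , _)
      with fromℕ< (<-trans i<j (<-trans j<k k<n)) | toℕ-fromℕ< (<-trans i<j (<-trans j<k k<n))
         | fromℕ< (<-trans j<k k<n) | toℕ-fromℕ< (<-trans j<k k<n)
         | fromℕ< k<n | toℕ-fromℕ< k<n
    ... | i′ | refl | j′ | refl | k′ | refl = no-pattern t i′ j′ k′ p
    from : Avoids132 n f → T (Defs.avoids132 v)
    from avoids = T-not⁺ λ t →
      let i , t = Equivalence.to (T-any-allFin _) t
          j , t = Equivalence.to (T-any-allFin _) t
          k , t = Equivalence.to (T-any-allFin _) t
      in avoids (toℕ i) (toℕ j) (toℕ k) (toℕ<n k) (Equivalence.to (pattern⇔ i j k) t)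

  perm : Involution n f → T (Defs.isPerm v)
  perm inv = Equivalence.from (T-all-allFin _) λ i → Equivalence.from (T-all-allFin _) λ j →
    ⇒ᵇ-not (λ i<j vi≡vj → <⇒≢ (<ᵇ⇒< _ _ i<j) (involution-injective n f inv (toℕ<n i) (toℕ<n j)
      (trans (sym (val≡f i)) (trans (≡ᵇ⇒≡ _ _ vi≡vj) (val≡f j)))))
    where
    ⇒ᵇ-not : ∀ {a b} → (T a → T b → ⊥) → T (a Defs.⇒ᵇ not b)
    ⇒ᵇ-not {false}         _ = _
    ⇒ᵇ-not {true}  {false} _ = _
    ⇒ᵇ-not {true}  {true}  h = h _ _

  displacement≡D : Defs.D v ≡ displacement n f
  displacement≡D = sum-allFin n (λ i → cong (λ x → ∣ x - toℕ i ∣) (val≡f i))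

  inversions≡I : Defs.I v ≡ inversions n f
  inversions≡I = sum-allFin n (λ i → sum-allFin n (λ j →
    cong₂ (λ x y → 𝟙 ((toℕ i <ᵇ toℕ j) ∧ (x <ᵇ y))) (val≡f j) (val≡f i)))

  -- In an involution i is the least point of its cycle exactly when i ≤ f i.
  cyc≡weakExcedances : Involution n f → Defs.cyc v ≡ weakExcedances n f
  cyc≡weakExcedances inv = sum-allFin n (λ i → cong 𝟙 (T-injective (first-iterate i) (all-iterates i)))
    where
    π : Fin n → Fin n
    π = lookup v
    ππ : ∀ i → π (π i) ≡ i
    ππ i = toℕ-injective (trans (sym (f∘f i)) (proj₂ (inv (toℕ i) (toℕ<n i))))
    first-iterate : ∀ i → T (all (λ k → toℕ i ≤ᵇ toℕ (iter π k i)) (upTo (suc n))) → T (toℕ i ≤ᵇ f (toℕ i))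
    first-iterate i t = subst (λ x → T (toℕ i ≤ᵇ x)) (val≡f i)
      (All.applyUpTo⁻ id (suc n) (all⁺ _ _ t) (s<s (<-≤-trans z<s (toℕ<n i))))
    all-iterates : ∀ i → T (toℕ i ≤ᵇ f (toℕ i)) → T (all (λ k → toℕ i ≤ᵇ toℕ (iter π k i)) (upTo (suc n)))
    all-iterates i t = all⁻ _ (All.applyUpTo⁺₂ id (suc n) iterate)
      where
      iterate : ∀ k → T (toℕ i ≤ᵇ toℕ (iter π k i))
      iterate k with iter-involution π i (ππ i) k
      ... | inj₁ πᵏi≡i  = subst (λ x → T (toℕ i ≤ᵇ toℕ x)) (sym πᵏi≡i) (≤⇒≤ᵇ (≤-refl {toℕ i}))
      ... | inj₂ πᵏi≡πi = subst (λ x → T (toℕ i ≤ᵇ x)) (trans (sym (val≡f i)) (cong toℕ (sym πᵏi≡πi))) t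

  transpositions≡T : Involution n f → Defs.T v ≡ transpositions n f
  transpositions≡T inv = begin
    n ∸ Defs.cyc v
      ≡⟨ cong (n ∸_) (cyc≡weakExcedances inv) ⟩
    n ∸ weakExcedances n f
      ≡⟨ cong (_∸ weakExcedances n f) (weakExcedances+transpositions n f) ⟨
    weakExcedances n f + transpositions n f ∸ weakExcedances n f
      ≡⟨ m+n∸m≡n (weakExcedances n f) _ ⟩
    transpositions n f ∎

  shallow⇔ : Involution n f → T (Defs.isShallow v) ⇔ Shallow n f
  shallow⇔ inv = mk⇔
    (λ t → subst₂ _≡_ statistics≡ displacement≡D (≡ᵇ⇒≡ _ _ t))
    (λ sh → ≡⇒≡ᵇ _ _ (subst₂ _≡_ (sym statistics≡) (sym displacement≡D) sh))
    where
    statistics≡ : Defs.I v + Defs.T v ≡ inversions n f + transpositions n f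
    statistics≡ = cong₂ _+_ inversions≡I (transpositions≡T inv)

  conditions : Bool
  conditions = Defs.isPerm v ∧ Defs.isInvolution v ∧ Defs.avoids132 v ∧ Defs.isShallow v

  isShallowInv132⇔ : T conditions ⇔ IsShallowInv132 n f
  isShallowInv132⇔ = mk⇔ to from
    where
    to : T conditions → IsShallowInv132 n f
    to t = let _ , t = Equivalence.to (T-∧ {Defs.isPerm v}) t
               tᵢ , t = Equivalence.to (T-∧ {Defs.isInvolution v}) t
               tₐ , tₛ = Equivalence.to (T-∧ {Defs.avoids132 v}) t
               inv = Equivalence.to involution⇔ tᵢ
           in inv , Equivalence.to avoids⇔ tₐ , Equivalence.to (shallow⇔ inv) tₛ
    from : IsShallowInv132 n f → T conditions
    from (inv , avoids , shallow) = Equivalence.from T-∧ (perm inv ,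
      Equivalence.from T-∧ (Equivalence.from involution⇔ inv ,
      Equivalence.from T-∧ (Equivalence.from avoids⇔ avoids , Equivalence.from (shallow⇔ inv) shallow)))

isShallowInv132 : ∀ {n} (x : ShallowInv132 n) → IsShallowInv132 n (toFun (proj₁ x))
isShallowInv132 (v , p) = Equivalence.to (Word.isShallowInv132⇔ v) p

-- The Fibonacci recurrence

IsShallowInv132-bounded : ∀ {n g} → IsShallowInv132 n g → ∀ i → i < n → g i < n
IsShallowInv132-bounded (inv , _) i i<n = proj₁ (inv i i<n)

-- The validity argument is irrelevant, so packing a function gives the same word whatever proof is supplied.
pack : ∀ n g → .(IsShallowInv132 n g) → ShallowInv132 n
pack n g valid-g = fromFun n g , recompute (T? _) (Equivalence.from (Word.isShallowInv132⇔ (fromFun n g))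
  (IsShallowInv132-cong n g _ (λ i i<n → sym (toFun-fromFun n g (IsShallowInv132-bounded valid-g) i i<n)) valid-g))

ShallowInv132-≡ : ∀ {n} (x y : ShallowInv132 n) → Agree n (toFun (proj₁ x)) (toFun (proj₁ y)) → x ≡ y
ShallowInv132-≡ (v , p) (w , q) eq with toFun-injective v w eq
... | refl = cong (v ,_) (T-irrelevant p q)

toFun-pack : ∀ n g .(valid-g : IsShallowInv132 n g) → Agree n (toFun (proj₁ (pack n g valid-g))) g
toFun-pack n g valid-g = toFun-fromFun n g (IsShallowInv132-bounded valid-g)

pack-≡ : ∀ n g .(valid-g : IsShallowInv132 n g) x → Agree n g (toFun (proj₁ x)) → pack n g valid-g ≡ x
pack-≡ n g valid-g x g≗x =
  ShallowInv132-≡ (pack n g valid-g) x (λ i i<n → trans (toFun-pack n g valid-g i i<n) (g≗x i i<n))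

module Step (n : ℕ) where

  LastMovedOrFixed : Vec (Fin (suc (suc n))) (suc (suc n)) → Set
  LastMovedOrFixed v = toFun v (suc n) < suc n ⊎ toFun v (suc n) ≡ suc n

  last-moved-or-fixed : ∀ v → LastMovedOrFixed v
  last-moved-or-fixed v = m<1+n⇒m<n∨m≡n (toFun-< v (suc n) ≤-refl)

  restricted : ∀ {h} → IsShallowInv132 (suc (suc n)) h → h (suc n) ≡ suc n → IsShallowInv132 (suc n) h
  restricted {h} valid fixed = Equivalence.to (IsShallowInv132-fixed-last (suc n) h fixed) valid

  unwrapped : ∀ {h} → IsShallowInv132 (suc (suc n)) h → h (suc n) < suc n → IsShallowInv132 n (unwrap h)
  unwrapped {h} valid moved = IsShallowInv132-unwrap n h valid (moved-last-is-zero (suc n) h valid moved)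

  split : ∀ v → IsShallowInv132 (suc (suc n)) (toFun v) → LastMovedOrFixed v →
          ShallowInv132 (suc n) ⊎ ShallowInv132 n
  split v valid (inj₂ fixed) = inj₁ (pack (suc n) (toFun v) (restricted valid fixed))
  split v valid (inj₁ moved) = inj₂ (pack n (unwrap (toFun v)) (unwrapped valid moved))

  to : ShallowInv132 (suc (suc n)) → ShallowInv132 (suc n) ⊎ ShallowInv132 n
  to x = split (proj₁ x) (isShallowInv132 x) (last-moved-or-fixed (proj₁ x))

  extended-valid : ∀ x → IsShallowInv132 (suc (suc n)) (fixAt (suc n) (toFun (proj₁ x)))
  extended-valid x = IsShallowInv132-fixAt (suc n) (toFun (proj₁ x)) (isShallowInv132 x)

  wrapped-valid : ∀ x → IsShallowInv132 (suc (suc n)) (wrap n (toFun (proj₁ x)))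
  wrapped-valid x = IsShallowInv132-wrap n (toFun (proj₁ x)) (isShallowInv132 x)

  from : ShallowInv132 (suc n) ⊎ ShallowInv132 n → ShallowInv132 (suc (suc n))
  from (inj₁ x) = pack (suc (suc n)) (fixAt (suc n) (toFun (proj₁ x))) (extended-valid x)
  from (inj₂ x) = pack (suc (suc n)) (wrap n (toFun (proj₁ x))) (wrapped-valid x)

  toFun-extended : ∀ x → Agree (suc (suc n)) (toFun (proj₁ (from (inj₁ x)))) (fixAt (suc n) (toFun (proj₁ x)))
  toFun-extended x = toFun-pack _ _ (extended-valid x)

  toFun-wrapped : ∀ x → Agree (suc (suc n)) (toFun (proj₁ (from (inj₂ x)))) (wrap n (toFun (proj₁ x)))
  toFun-wrapped x = toFun-pack _ _ (wrapped-valid x)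

  to∘from : ∀ y → to (from y) ≡ y
  to∘from y = split-from y (isShallowInv132 (from y)) (last-moved-or-fixed (proj₁ (from y)))
    where
    split-from : ∀ y valid (c : LastMovedOrFixed (proj₁ (from y))) → split (proj₁ (from y)) valid c ≡ y
    split-from (inj₁ x) valid (inj₂ fixed) = cong inj₁ (pack-≡ _ _ (restricted valid fixed) x (λ i i<1+n →
      trans (toFun-extended x i (m<n⇒m<1+n i<1+n)) (fixAt-agree (suc n) (toFun (proj₁ x)) i i<1+n)))
    split-from (inj₁ x) valid (inj₁ moved) =
      ⊥-elim (<-irrefl (trans (toFun-extended x (suc n) ≤-refl) (fixAt-≡ (suc n) (toFun (proj₁ x)))) moved)
    split-from (inj₂ x) valid (inj₂ fixed) =
      ⊥-elim (0≢1+n (trans (sym (trans (toFun-wrapped x (suc n) ≤-refl) (wrap-last n (toFun (proj₁ x))))) fixed))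
    split-from (inj₂ x) valid (inj₁ moved) = cong inj₂ (pack-≡ _ _ (unwrapped valid moved) x (λ i i<n →
      trans (cong pred (toFun-wrapped x (suc i) (s<s (m<n⇒m<1+n i<n)))) (unwrap-wrap n (toFun (proj₁ x)) i i<n)))

  from∘to : ∀ x → from (to x) ≡ x
  from∘to x = from-split (isShallowInv132 x) (last-moved-or-fixed (proj₁ x))
    where
    h : ℕ → ℕ
    h = toFun (proj₁ x)
    from-split : ∀ valid (c : LastMovedOrFixed (proj₁ x)) → from (split (proj₁ x) valid c) ≡ x
    from-split valid (inj₂ fixed) = pack-≡ _ _ (extended-valid r) x
      (fixAt-cong (suc n) (toFun (proj₁ r)) h (toFun-pack (suc n) h (restricted valid fixed)) fixed)
      where
      r : ShallowInv132 (suc n)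
      r = pack (suc n) h (restricted valid fixed)
    from-split valid@(inv , _) (inj₁ moved) = pack-≡ _ _ (wrapped-valid r) x (λ i i<2+n →
      trans (wrap-cong n (toFun (proj₁ r)) (unwrap h) (toFun-pack n (unwrap h) (unwrapped valid moved)) i i<2+n)
            (sym (Unwrap.wrap-unwrap inv (moved-last-is-zero (suc n) h valid moved) i i<2+n)))
      where
      r : ShallowInv132 n
      r = pack n (unwrap h) (unwrapped valid moved)

  iso : ShallowInv132 (suc (suc n)) ↔ (ShallowInv132 (suc n) ⊎ ShallowInv132 n)
  iso = mk↔ₛ′ to from to∘from from∘to

shallowInv132↔fib : ∀ n → ShallowInv132 n ↔ Fin (fib (suc n))
shallowInv132↔fib zero          = mk↔ₛ′ (λ _ → Fin.zero) (λ _ → [] , _)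
  (λ { Fin.zero → refl ; (Fin.suc ()) }) (λ { ([] , _) → refl })
shallowInv132↔fib (suc zero)    = mk↔ₛ′ (λ _ → Fin.zero) (λ _ → (Fin.zero ∷ []) , _)
  (λ { Fin.zero → refl ; (Fin.suc ()) }) (λ { ((Fin.zero ∷ []) , _) → refl ; ((Fin.suc () ∷ []) , _) })
shallowInv132↔fib (suc (suc n)) =
  ↔-sym (+↔⊎ {fib (suc (suc n))} {fib (suc n)}) ↔-∘
  ((shallowInv132↔fib (suc n) ⊎-↔ shallowInv132↔fib n) ↔-∘ Step.iso n)

theorem3p6 : (n : ℕ) → n ≥ 1 → ShallowInv132 n ↔ Fin (fib (suc n))
theorem3p6 n _ = shallowInv132↔fib n
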